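{- Let $t$ be an odd integer, $\epsilon=\left(\frac{t}{2}\right)$, and let $D$ be a discriminant form of type $2_1^{+1}4_t^{\epsilon}8_{I\!I}^{+2}$. Then the orthogonal group $\operatorname{O}(D)$ acts transitively on $I\setminus I_4$.
   Context: A discriminant form is a finite abelian group with a nondegenerate quadratic form $\operatorname{q}:D\to\mathbb Q/\mathbb Z$. A discriminant form of type $2_1^{+1}4_t^{\epsilon}8_{I\!I}^{+2}$ with $t$ odd and $\epsilon=(\frac t2)$ (where $(\frac t2)=1$ if $t\equiv\pm1\bmod8$, $-1$ if $t\equiv\pm3\bmod8$) can be described as the group $\mathbb Z/2\times\mathbb Z/4\times\mathbb Z/8\times\mathbb Z/8$ with elements $(a,b,c,d)$ and quadratic form $\operatorname{q}(a,b,c,d)=\frac{a^2}{4}+\frac{tb^2}{8}+\frac{cd}{8}\bmod1$. $I$ is the set of isotropic elements ($\operatorname{q}=0$), $D_4=\{\gamma:4\gamma=0\}$, $I_4=I\cap D_4$. $\operatorname{O}(D)$ is the group of group automorphisms of $D$ preserving $\operatorname{q}$. -}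

module Defs where

open import Data.Nat as ℕ using (ℕ)
open import Data.Nat.DivMod using (_mod_)
open import Data.Fin using (Fin; toℕ)
open import Data.Product using (_×_; _,_; Σ)
open import Data.Integer as ℤ using (ℤ; +_)
open import Data.Integer.DivMod using (_%ℕ_)
open import Relation.Binary.PropositionalEquality using (_≡_)
open import Relation.Nullary using (¬_)
open import Function.Definitions using (Bijective)

D : Set
D = Fin 2 × Fin 4 × Fin 8 × Fin 8

_⊕_ : D → D → D
(a , b , c , d) ⊕ (a' , b' , c' , d') =
  ((toℕ a ℕ.+ toℕ a') mod 2 , (toℕ b ℕ.+ toℕ b') mod 4 ,
   (toℕ c ℕ.+ toℕ c') mod 8 , (toℕ d ℕ.+ toℕ d') mod 8)

infixl 6 _⊕_

𝟎 : D
𝟎 = (0 mod 2 , 0 mod 4 , 0 mod 8 , 0 mod 8)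

4· : D → D
4· x = x ⊕ x ⊕ x ⊕ x

-- The quadratic form q(a,b,c,d) = a²/4 + t b²/8 + c d/8 mod 1.
-- All its values lie in (1/8)ℤ/ℤ ⊂ ℚ/ℤ; we represent the value k/8 mod 1
-- by k : Fin 8, i.e.  q t x = 8·q(x) mod 8.
q : ℤ → D → Fin 8
q t (a , b , c , d) =
  ( (+ (2 ℕ.* toℕ a ℕ.* toℕ a)) ℤ.+ t ℤ.* (+ (toℕ b ℕ.* toℕ b))
      ℤ.+ (+ (toℕ c ℕ.* toℕ d)) ) %ℕ 8 mod 8

Isotropic : ℤ → D → Set
Isotropic t x = q t x ≡ q t 𝟎

InD₄ : D → Set
InD₄ x = 4· x ≡ 𝟎

InI∖I₄ : ℤ → D → Set
InI∖I₄ t x = Isotropic t x × ¬ InD₄ x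

record O (t : ℤ) : Set where
  field
    σ        : D → D
    additive : ∀ x y → σ (x ⊕ y) ≡ σ x ⊕ σ y
    bijective : Bijective _≡_ _≡_ σ
    preserves : ∀ x → q t (σ x) ≡ q t x

{-# OPTIONS --safe #-}
-- Let e = (0,0,0,1). If x = (a,b,c,d) is isotropic with d odd, the Eichler transformation
-- with parameters (a,b) sends e to (a, b, −(2a² + tb²), 1), and scaling (c,d) by the unit d
-- then gives (a, b, −d(2a² + tb²), d) = x, because isotropy says cd ≡ −(2a² + tb²) mod 8 and
-- d² ≡ 1 mod 8. If d is even then c is odd (x ∉ D₄), and swapping c and d reduces to the
-- first case. So I ∖ I₄ is the O(D)-orbit of e. As q depends on t only mod 8, that these
-- maps are isometries carrying e where claimed is a finite computation for each residue.
module Submission where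

open import Defs
open import Data.Integer using (ℤ; +_)
open import Data.Integer.Divisibility using (_∣_)
open import Data.Product using (Σ)
open import Relation.Binary.PropositionalEquality using (_≡_)
open import Relation.Nullary using (¬_)

open import Data.Nat as ℕ using (ℕ; zero; suc; NonZero; _<_; _≤_)
open import Data.Nat.Properties as ℕ using (<⇒≱; m≤m+n; m≤n+m)
open import Data.Nat.DivMod using (_mod_; _%_; _/_; m≡m%n+[m/n]*n; %-distribˡ-+; %-remove-+ʳ)
open import Data.Nat.Divisibility using (_∣?_; ∣n⇒∣m*n) renaming (_∣_ to _∣ℕ_)
open import Data.Integer using (-[1+_])
open import Data.Integer.DivMod using (_%ℕ_; _/ℕ_; a≡a%ℕn+[a/ℕn]*n; n%ℕd<d)
open import Data.Integer.Properties using (pos-+; pos-*; +-injective; +-identityʳ)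
open import Data.Fin as Fin using (Fin; toℕ; zero; suc; fromℕ<; quotient; remainder)
open import Data.Fin.Properties using (toℕ-fromℕ<; toℕ-injective; all?)
open import Data.Product using (_×_; _,_; proj₁; proj₂)
open import Data.Product.Properties using (≡-dec)
open import Data.Empty using (⊥-elim)
open import Relation.Binary.PropositionalEquality
  using (refl; sym; trans; cong; cong₂; subst; module ≡-Reasoning)
open import Relation.Nullary using (Dec; ¬?)
open import Relation.Nullary.Decidable using (map′; _×-dec_; _→-dec_; from-yes)
open import Relation.Unary using (Decidable)
open import Function.Consequences.Propositional
  using (inverseᵇ⇒bijective; strictlyInverseˡ⇒inverseˡ; strictlyInverseʳ⇒inverseʳ)
import Function.Construct.Composition as Composition
import Function.Construct.Symmetry as Symmetry

module _ where
  open import Data.Integer using (_+_; _*_; _-_; -_)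
  open import Data.Integer.Tactic.RingSolver using (solve-∀)

  %ℕ-unique : ∀ {n r s} k → r < n → s < n → + r ≡ + s + k * + n → r ≡ s
  %ℕ-unique {s = s} (+ zero) _ _ eq = +-injective (trans eq (+-identityʳ (+ s)))
  %ℕ-unique (+ suc k) r<n _ eq = ⊥-elim (<⇒≱ r<n (positive-multiple k eq))
    where
    positive-multiple : ∀ {n r s} k → + r ≡ + s + + suc k * + n → n ≤ r
    positive-multiple {n} {r} {s} k eq = begin
      n                  ≤⟨ m≤m+n n (k ℕ.* n) ⟩
      suc k ℕ.* n        ≤⟨ m≤n+m _ s ⟩
      s ℕ.+ suc k ℕ.* n  ≡⟨ +-injective r≡ ⟨
      r                  ∎
      where
      open ℕ.≤-Reasoning
      r≡ : + r ≡ + (s ℕ.+ suc k ℕ.* n)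
      r≡ = trans eq (trans (cong (_+_ (+ s)) (sym (pos-* (suc k) n))) (sym (pos-+ s _)))
  %ℕ-unique {n} {r} {s} -[1+ k ] r<n s<n eq = sym (%ℕ-unique (+ suc k) s<n r<n
    (trans (shift (+ s) -[1+ k ] (+ n)) (cong (λ z → z + + suc k * + n) (sym eq))))
    where
    shift : ∀ s j m → s ≡ (s + j * m) + (- j) * m
    shift = solve-∀

  [i+k*n]%ℕn≡i%ℕn : ∀ i k n .{{_ : NonZero n}} → (i + k * + n) %ℕ n ≡ i %ℕ n
  [i+k*n]%ℕn≡i%ℕn i k n = %ℕ-unique (i /ℕ n + k - j /ℕ n) (n%ℕd<d j n) (n%ℕd<d i n) (begin
    + (j %ℕ n)
      ≡⟨ cancel (+ (j %ℕ n)) (j /ℕ n) (+ n) ⟩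
    (+ (j %ℕ n) + j /ℕ n * + n) - j /ℕ n * + n
      ≡⟨ cong (_- j /ℕ n * + n) (a≡a%ℕn+[a/ℕn]*n j n) ⟨
    (i + k * + n) - j /ℕ n * + n
      ≡⟨ cong (λ z → (z + k * + n) - j /ℕ n * + n) (a≡a%ℕn+[a/ℕn]*n i n) ⟩
    ((+ (i %ℕ n) + i /ℕ n * + n) + k * + n) - j /ℕ n * + n
      ≡⟨ regroup (+ (i %ℕ n)) (i /ℕ n) k (j /ℕ n) (+ n) ⟩
    + (i %ℕ n) + (i /ℕ n + k - j /ℕ n) * + n
      ∎)
    where
    open ≡-Reasoning
    j = i + k * + n
    cancel : ∀ r p m → r ≡ (r + p * m) - p * m
    cancel = solve-∀
    regroup : ∀ r p k p' m → ((r + p * m) + k * m) - p' * m ≡ r + (p + k - p') * m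
    regroup = solve-∀

  q-residue : ∀ t x → q t x ≡ q (+ (t %ℕ 8)) x
  q-residue t (a , b , c , d) = cong (_mod 8) (begin
    (A + t * B + C) %ℕ 8
      ≡⟨ cong (λ s → (A + s * B + C) %ℕ 8) (a≡a%ℕn+[a/ℕn]*n t 8) ⟩
    (A + (+ r + t /ℕ 8 * + 8) * B + C) %ℕ 8
      ≡⟨ cong (_%ℕ 8) (regroup A (+ r) (t /ℕ 8) B C) ⟩
    ((A + + r * B + C) + t /ℕ 8 * B * + 8) %ℕ 8
      ≡⟨ [i+k*n]%ℕn≡i%ℕn (A + + r * B + C) (t /ℕ 8 * B) 8 ⟩
    (A + + r * B + C) %ℕ 8
      ∎)
    where
    open ≡-Reasoning
    r = t %ℕ 8
    A = + (2 ℕ.* toℕ a ℕ.* toℕ a)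
    B = + (toℕ b ℕ.* toℕ b)
    C = + (toℕ c ℕ.* toℕ d)
    regroup : ∀ A r k B C → A + (r + k * + 8) * B + C ≡ (A + r * B + C) + k * B * + 8
    regroup = solve-∀

open import Data.Nat using (_+_; _*_)
open import Data.Nat.Tactic.RingSolver using (solve-∀)

Row : Set
Row = ℕ × ℕ × ℕ × ℕ

Matrix : Set
Matrix = Row × Row × Row × Row

linear : Row → D → ℕ
linear (m₁ , m₂ , m₃ , m₄) (a , b , c , d) = m₁ * toℕ a + m₂ * toℕ b + m₃ * toℕ c + m₄ * toℕ d

apply : Matrix → D → D
apply (r₁ , r₂ , r₃ , r₄) x =
  linear r₁ x mod 2 , linear r₂ x mod 4 , linear r₃ x mod 8 , linear r₄ x mod 8

-- The coordinates of D have orders 2, 4, 8, 8; this makes a row read mod n additive.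
RowRespectsOrders : ℕ → Row → Set
RowRespectsOrders n (m₁ , m₂ , m₃ , m₄) = n ∣ℕ m₁ * 2 × n ∣ℕ m₂ * 4 × n ∣ℕ m₃ * 8 × n ∣ℕ m₄ * 8

RespectsOrders : Matrix → Set
RespectsOrders (r₁ , r₂ , r₃ , r₄) =
  RowRespectsOrders 2 r₁ × RowRespectsOrders 4 r₂ × RowRespectsOrders 8 r₃ × RowRespectsOrders 8 r₄

module _ {n : ℕ} .{{_ : NonZero n}} where

  toℕ-mod : ∀ m → toℕ (m mod n) ≡ m % n
  toℕ-mod m = toℕ-fromℕ< _

  +-cong-% : ∀ {a a' b b'} → a % n ≡ a' % n → b % n ≡ b' % n → (a + b) % n ≡ (a' + b') % n
  +-cong-% {a} {a'} {b} {b'} ea eb = begin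
    (a + b) % n              ≡⟨ %-distribˡ-+ a b n ⟩
    (a % n + b % n) % n      ≡⟨ cong₂ (λ u v → (u + v) % n) ea eb ⟩
    (a' % n + b' % n) % n    ≡⟨ %-distribˡ-+ a' b' n ⟨
    (a' + b') % n            ∎
    where open ≡-Reasoning

  *-mod-cong : ∀ m k .{{_ : NonZero k}} u → n ∣ℕ m * k → (m * toℕ (u mod k)) % n ≡ (m * u) % n
  *-mod-cong m k u n∣mk = begin
    (m * toℕ (u mod k)) % n                    ≡⟨ cong (λ v → (m * v) % n) (toℕ-fromℕ< _) ⟩
    (m * (u % k)) % n                          ≡⟨ %-remove-+ʳ (m * (u % k)) (∣n⇒∣m*n (u / k) n∣mk) ⟨
    (m * (u % k) + u / k * (m * k)) % n        ≡⟨ cong (_% n) (regroup m (u % k) (u / k) k) ⟩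
    (m * (u % k + u / k * k)) % n              ≡⟨ cong (λ v → (m * v) % n) (m≡m%n+[m/n]*n u k) ⟨
    (m * u) % n                                ∎
    where
    open ≡-Reasoning
    regroup : ∀ m r s k → m * r + s * (m * k) ≡ m * (r + s * k)
    regroup = solve-∀

  linear-⊕ : ∀ r → RowRespectsOrders n r → ∀ x y → linear r (x ⊕ y) % n ≡ (linear r x + linear r y) % n
  linear-⊕ r@(m₁ , m₂ , m₃ , m₄) (h₁ , h₂ , h₃ , h₄) x@(a , b , c , d) y@(a' , b' , c' , d') = begin
    linear r (x ⊕ y) % n
      ≡⟨ +-cong-% (+-cong-% (+-cong-% (*-mod-cong m₁ 2 _ h₁) (*-mod-cong m₂ 4 _ h₂))
                                      (*-mod-cong m₃ 8 _ h₃)) (*-mod-cong m₄ 8 _ h₄) ⟩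
    (m₁ * (toℕ a + toℕ a') + m₂ * (toℕ b + toℕ b') + m₃ * (toℕ c + toℕ c') + m₄ * (toℕ d + toℕ d')) % n
      ≡⟨ cong (_% n) (distribute m₁ m₂ m₃ m₄ (toℕ a) (toℕ b) (toℕ c) (toℕ d)
                                            (toℕ a') (toℕ b') (toℕ c') (toℕ d')) ⟩
    (linear r x + linear r y) % n
      ∎
    where
    open ≡-Reasoning
    distribute : ∀ m₁ m₂ m₃ m₄ a b c d a' b' c' d' →
      m₁ * (a + a') + m₂ * (b + b') + m₃ * (c + c') + m₄ * (d + d') ≡
      (m₁ * a + m₂ * b + m₃ * c + m₄ * d) + (m₁ * a' + m₂ * b' + m₃ * c' + m₄ * d')
    distribute = solve-∀

  linear-mod-⊕ : ∀ r → RowRespectsOrders n r → ∀ x y →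
    linear r (x ⊕ y) mod n ≡ (toℕ (linear r x mod n) + toℕ (linear r y mod n)) mod n
  linear-mod-⊕ r h x y = toℕ-injective (begin
    toℕ (linear r (x ⊕ y) mod n)
      ≡⟨ toℕ-mod (linear r (x ⊕ y)) ⟩
    linear r (x ⊕ y) % n
      ≡⟨ linear-⊕ r h x y ⟩
    (linear r x + linear r y) % n
      ≡⟨ %-distribˡ-+ (linear r x) (linear r y) n ⟩
    (linear r x % n + linear r y % n) % n
      ≡⟨ cong₂ (λ u v → (u + v) % n) (toℕ-mod (linear r x)) (toℕ-mod (linear r y)) ⟨
    (toℕ (linear r x mod n) + toℕ (linear r y mod n)) % n
      ≡⟨ toℕ-mod _ ⟨
    toℕ ((toℕ (linear r x mod n) + toℕ (linear r y mod n)) mod n)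
      ∎)
    where open ≡-Reasoning

apply-⊕ : ∀ M → RespectsOrders M → ∀ x y → apply M (x ⊕ y) ≡ apply M x ⊕ apply M y
apply-⊕ (r₁ , r₂ , r₃ , r₄) (h₁ , h₂ , h₃ , h₄) x y =
  cong₂ _,_ (linear-mod-⊕ r₁ h₁ x y) (cong₂ _,_ (linear-mod-⊕ r₂ h₂ x y)
    (cong₂ _,_ (linear-mod-⊕ r₃ h₃ x y) (linear-mod-⊕ r₄ h₄ x y)))

record IsometryPair (t : ℤ) (M N : Matrix) : Set where
  field
    respects      : RespectsOrders M
    left-inverse  : ∀ x → apply N (apply M x) ≡ x
    right-inverse : ∀ y → apply M (apply N y) ≡ y
    preserves     : ∀ x → q t (apply M x) ≡ q t x

isometry : ∀ {t M N} → IsometryPair t M N → O t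
isometry {M = M} p = record
  { σ = apply M
  ; additive = apply-⊕ M respects
  ; bijective = inverseᵇ⇒bijective (strictlyInverseˡ⇒inverseˡ (apply M) right-inverse ,
                                     strictlyInverseʳ⇒inverseʳ (apply M) left-inverse)
  ; preserves = preserves
  }
  where open IsometryPair p

module _ {t : ℤ} where

  infixr 9 _∘O_
  _∘O_ : O t → O t → O t
  g ∘O h = record
    { σ = λ x → O.σ g (O.σ h x)
    ; additive = λ x y → trans (cong (O.σ g) (O.additive h x y)) (O.additive g _ _)
    ; bijective = Composition.bijective _≡_ _≡_ _≡_ (O.bijective h) (O.bijective g)
    ; preserves = λ x → trans (O.preserves g _) (O.preserves h x)
    }

  σ-injective : ∀ (g : O t) {x y} → O.σ g x ≡ O.σ g y → x ≡ y
  σ-injective g = proj₁ (O.bijective g)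

  σ-section : ∀ (g : O t) y → O.σ g (proj₁ (proj₂ (O.bijective g) y)) ≡ y
  σ-section g y = proj₂ (proj₂ (O.bijective g) y) refl

  _⁻¹ : O t → O t
  g ⁻¹ = record
    { σ = σ⁻¹
    ; additive = λ x y → σ-injective g (begin
        O.σ g (σ⁻¹ (x ⊕ y))            ≡⟨ σ-section g (x ⊕ y) ⟩
        x ⊕ y                          ≡⟨ cong₂ _⊕_ (σ-section g x) (σ-section g y) ⟨
        O.σ g (σ⁻¹ x) ⊕ O.σ g (σ⁻¹ y)  ≡⟨ O.additive g (σ⁻¹ x) (σ⁻¹ y) ⟨
        O.σ g (σ⁻¹ x ⊕ σ⁻¹ y)          ∎)
    ; bijective = Symmetry.bijective (O.bijective g) refl sym trans (cong (O.σ g))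
    ; preserves = λ y → trans (sym (O.preserves g (σ⁻¹ y))) (cong (q t) (σ-section g y))
    }
    where
    open ≡-Reasoning
    σ⁻¹ : D → D
    σ⁻¹ y = proj₁ (proj₂ (O.bijective g) y)

  ⁻¹-sends : ∀ (g : O t) {x y} → O.σ g x ≡ y → O.σ (g ⁻¹) y ≡ x
  ⁻¹-sends g {x} refl = σ-injective g (σ-section g (O.σ g x))

infix 4 _≟D_
_≟D_ : (x y : D) → Dec (x ≡ y)
_≟D_ = ≡-dec Fin._≟_ (≡-dec Fin._≟_ (≡-dec Fin._≟_ Fin._≟_))

all-D? : {P : D → Set} → Decidable P → Dec (∀ x → P x)
all-D? P? = map′ (λ h (a , b , c , d) → h a b c d) (λ h a b c d → h (a , b , c , d))
  (all? λ a → all? λ b → all? λ c → all? λ d → P? (a , b , c , d))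

respectsOrders? : ∀ M → Dec (RespectsOrders M)
respectsOrders? (r₁ , r₂ , r₃ , r₄) = row? 2 r₁ ×-dec row? 4 r₂ ×-dec row? 8 r₃ ×-dec row? 8 r₄
  where
  row? : ∀ n r → Dec (RowRespectsOrders n r)
  row? n (m₁ , m₂ , m₃ , m₄) = n ∣? m₁ * 2 ×-dec n ∣? m₂ * 4 ×-dec n ∣? m₃ * 8 ×-dec n ∣? m₄ * 8

isometryPair? : ∀ t M N → Dec (IsometryPair t M N)
isometryPair? t M N =
  map′ (λ (o , l , r , p) → record { respects = o ; left-inverse = l ; right-inverse = r ; preserves = p })
       (λ p → let open IsometryPair p in respects , left-inverse , right-inverse , preserves)
       (respectsOrders? M ×-dec all-D? (λ x → apply N (apply M x) ≟D x) ×-dec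
        all-D? (λ y → apply M (apply N y) ≟D y) ×-dec all-D? (λ x → q t (apply M x) Fin.≟ q t x))

-- The Eichler transformation x ↦ x + d·(α , β) for the hyperbolic pair of 8_II^{+2}; its
-- c-row −4αa − 2rβb − (2α² + rβ²)d (signs written as 4, 6, 7 mod 8) is forced by q-invariance.
-- Since −α ≡ α mod 2, its inverse is the transformation for (α , −β) = (α , 3β).
eichler : (r α β : ℕ) → Matrix
eichler r α β =
  (1     , 0         , 0 , α) ,
  (0     , 1         , 0 , β) ,
  (4 * α , 6 * r * β , 1 , 7 * (2 * α * α + r * β * β)) ,
  (0     , 0         , 0 , 1)

eichler-isometry : ∀ (r : Fin 8) (α : Fin 2) (β : Fin 4) →
  IsometryPair (+ toℕ r) (eichler (toℕ r) (toℕ α) (toℕ β)) (eichler (toℕ r) (toℕ α) (3 * toℕ β))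
eichler-isometry = from-yes (all? {n = 8} λ r → all? {n = 2} λ α → all? {n = 4} λ β →
  isometryPair? (+ toℕ r) (eichler (toℕ r) (toℕ α) (toℕ β)) (eichler (toℕ r) (toℕ α) (3 * toℕ β)))

-- For odd u, u² ≡ 1 mod 8, so (c , d) ↦ (uc , ud) preserves cd/8 and is an involution.
scaling : ℕ → Matrix
scaling u = (1 , 0 , 0 , 0) , (0 , 1 , 0 , 0) , (0 , 0 , u , 0) , (0 , 0 , 0 , u)

scaling-isometry : ∀ (r : Fin 8) (k : Fin 4) →
  IsometryPair (+ toℕ r) (scaling (1 + 2 * toℕ k)) (scaling (1 + 2 * toℕ k))
scaling-isometry = from-yes (all? {n = 8} λ r → all? {n = 4} λ k →
  isometryPair? (+ toℕ r) (scaling (1 + 2 * toℕ k)) (scaling (1 + 2 * toℕ k)))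

swap : Matrix
swap = (1 , 0 , 0 , 0) , (0 , 1 , 0 , 0) , (0 , 0 , 0 , 1) , (0 , 0 , 1 , 0)

swap-isometry : ∀ (r : Fin 8) → IsometryPair (+ toℕ r) swap swap
swap-isometry = from-yes (all? {n = 8} λ r → isometryPair? (+ toℕ r) swap swap)

module _ (r : Fin 8) where

  eichlerᴼ : Fin 2 → Fin 4 → O (+ toℕ r)
  eichlerᴼ α β = isometry (eichler-isometry r α β)

  scalingᴼ : Fin 4 → O (+ toℕ r)
  scalingᴼ k = isometry (scaling-isometry r k)

  swapᴼ : O (+ toℕ r)
  swapᴼ = isometry (swap-isometry r)

x₀ : D
x₀ = zero , zero , zero , suc zero

carrier : (r : Fin 8) → D → O (+ toℕ r)
carrier r (a , b , c , d) with remainder {4} 2 d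
... | zero  = swapᴼ r ∘O scalingᴼ r (quotient 2 c) ∘O eichlerᴼ r a b
... | suc _ = scalingᴼ r (quotient 2 d) ∘O eichlerᴼ r a b

inI∖I₄? : ∀ t x → Dec (InI∖I₄ t x)
inI∖I₄? t x = q t x Fin.≟ q t 𝟎 ×-dec ¬? (4· x ≟D 𝟎)

carrier-sends : ∀ (r : Fin 8) x → InI∖I₄ (+ toℕ r) x → O.σ (carrier r x) x₀ ≡ x
carrier-sends = from-yes (all? {n = 8} λ r → all-D? λ x →
  inI∖I₄? (+ toℕ r) x →-dec (O.σ (carrier r x) x₀ ≟D x))

OrbitTransitive : ℤ → Set
OrbitTransitive t = ∀ x y → InI∖I₄ t x → InI∖I₄ t y → Σ (O t) (λ g → O.σ g x ≡ y)

module _ {t t′ : ℤ} (q≗ : ∀ x → q t x ≡ q t′ x) where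

  InI∖I₄-resp : ∀ {x} → InI∖I₄ t x → InI∖I₄ t′ x
  InI∖I₄-resp {x} (isotropic , x∉D₄) = trans (sym (q≗ x)) (trans isotropic (q≗ 𝟎)) , x∉D₄

  O-resp : O t′ → O t
  O-resp g = record
    { σ = O.σ g ; additive = O.additive g ; bijective = O.bijective g
    ; preserves = λ x → trans (q≗ (O.σ g x)) (trans (O.preserves g x) (sym (q≗ x)))
    }

  orbitTransitive-resp : OrbitTransitive t′ → OrbitTransitive t
  orbitTransitive-resp transitive′ x y x∈ y∈ =
    let g , gx≡y = transitive′ x y (InI∖I₄-resp {x} x∈) (InI∖I₄-resp {y} y∈) in O-resp g , gx≡y

orbitTransitive-residue : (r : Fin 8) → OrbitTransitive (+ toℕ r)
orbitTransitive-residue r x y x∈ y∈ = carrier r y ∘O carrier r x ⁻¹ , (begin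
  O.σ (carrier r y) (O.σ (carrier r x ⁻¹) x)
    ≡⟨ cong (O.σ (carrier r y)) (⁻¹-sends (carrier r x) (carrier-sends r x x∈)) ⟩
  O.σ (carrier r y) x₀
    ≡⟨ carrier-sends r y y∈ ⟩
  y ∎)
  where open ≡-Reasoning

orbitTransitive : ∀ t → OrbitTransitive t
orbitTransitive t = orbitTransitive-resp (q-residue t)
  (subst (λ r → OrbitTransitive (+ r)) (toℕ-fromℕ< r<8) (orbitTransitive-residue (fromℕ< r<8)))
  where
  r<8 : t %ℕ 8 < 8
  r<8 = n%ℕd<d t 8

proposition5p5 : (t : ℤ) → ¬ (+ 2 ∣ t) →
    (x y : D) → InI∖I₄ t x → InI∖I₄ t y →
    Σ (O t) (λ g → O.σ g x ≡ y)
proposition5p5 t _ = orbitTransitive t
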